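{- For $n \geq 0$ and $\ell \geq 1$ the polynomials $\gamma(P_n^\ell,x)$ satisfy: (A1) $\gamma(P_0^\ell,x)=1$; (A2) $\gamma(P_1^\ell,x)=x$; (A3) $\gamma(P_n^\ell,x) = nx + x\sum_{j=1}^{n-1} \gamma(P_{n-j}^\ell,x)$ for $2 \leq n \leq \ell+1$; (A4) $\gamma(P_n^\ell,x) = (2\ell+2-n)x + x\sum_{j=1}^{n-1} \gamma(P_{n-j}^\ell,x)$ for $\ell+2 \leq n \leq 2\ell$; (A5) $\gamma(P_n^\ell,x) = x\sum_{j=1}^{2\ell+1} \gamma(P_{n-j}^\ell,x)$ for $n \geq 2\ell+1$. Alternatively, they satisfy: (B1) $\gamma(P_0^{\ell},x)=1$; (B2) $\gamma(P_n^{\ell},x) = (1+x)^n -1$ for $1 \leq n \leq \ell+1$; (B3) $\gamma(P_n^{\ell},x) = (1+x)\gamma(P_{n-1}^{\ell},x) - x$ for $\ell+2 \leq n \leq 2\ell+1$; (B4) $\gamma(P_n^{\ell},x) = (1+x)\gamma(P_{n-1}^{\ell},x) - x\gamma(P_{n-2(\ell+1)}^{\ell},x)$ for $n \geq 2\ell+2$.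
   Context: A dominating set in a graph $G$ is a set $D$ of vertices such that every vertex of $G$ is in $D$ or adjacent to a vertex of $D$. $\gamma_k(G)$ denotes the number of dominating sets of $G$ of size $k$, and the domination polynomial is $\gamma(G,x)=\sum_{k\geq 0}\gamma_k(G)x^k$. For a graph $G$ and positive integer $\ell$, the $\ell$th power of $G$ is the graph on the same vertex set in which two distinct vertices are adjacent iff their distance in $G$ is at most $\ell$. $P^\ell_n$ is the $\ell$th power of the path on $n$ vertices; $P^\ell_0$ is the graph with no vertices, which has exactly one dominating set (the empty set). -}

module Defs where

open import Data.Nat using (ℕ; zero; suc; _≤_; _≤?_; ∣_-_∣; _∸_)
open import Data.Integer as ℤ using (ℤ; +_)
open import Data.Fin using (Fin; toℕ; _≟_)
open import Data.Fin.Subset using (Subset; _∈_; ∣_∣)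
open import Data.Fin.Subset.Properties using (_∈?_)
open import Data.Fin.Properties using (any?; all?)
open import Data.Bool using (Bool; true; false)
open import Data.Vec using (Vec; []; _∷_)
open import Data.List using (List; []; _∷_; map; _++_; filter; length; upTo)
open import Data.Product using (Σ; ∃; _×_; _,_)
open import Data.Sum using (_⊎_)
open import Relation.Nullary using (¬_; Dec)
open import Relation.Nullary.Decidable using (_×-dec_; _⊎-dec_; ¬?)
open import Relation.Binary.PropositionalEquality using (_≡_)
open import Relation.Binary using (Decidable)
open import Relation.Unary using (Pred)

record Graph : Set₁ where
  field
    size : ℕ
    Adj  : Fin size → Fin size → Set
    adj? : ∀ u v → Dec (Adj u v)
open Graph public

Dominating : (G : Graph) → Subset (size G) → Set
Dominating G D = ∀ v → (v ∈ D) ⊎ (∃ λ u → u ∈ D × Adj G u v)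

dominating? : (G : Graph) → (D : Subset (size G)) → Dec (Dominating G D)
dominating? G D = all? λ v → (v ∈? D) ⊎-dec any? (λ u → (u ∈? D) ×-dec adj? G u v)

allSubsets : (n : ℕ) → List (Subset n)
allSubsets zero = [] ∷ []
allSubsets (suc n) = map (false ∷_) (allSubsets n) ++ map (true ∷_) (allSubsets n)

domCount : (G : Graph) → ℕ → ℕ
domCount G k =
  length (filter (λ D → dominating? G D ×-dec (∣ D ∣ Data.Nat.≟ k)) (allSubsets (size G)))

pathPower : (ℓ n : ℕ) → Graph
pathPower ℓ n = record
  { size = n
  ; Adj  = λ i j → (¬ i ≡ j) × (∣ toℕ i - toℕ j ∣ ≤ ℓ)
  ; adj? = λ i j → ¬? (i ≟ j) ×-dec (∣ toℕ i - toℕ j ∣ ≤? ℓ)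
  }

-- Polynomials with integer coefficients, as coefficient sequences
-- (p k = coefficient of x^k); equality is coefficientwise.

Poly : Set
Poly = ℕ → ℤ

_≈ₚ_ : Poly → Poly → Set
p ≈ₚ q = ∀ k → p k ≡ q k

infix 4 _≈ₚ_
infixl 6 _+ₚ_ _-ₚ_
infixl 7 _*ₚ_ _·ₚ_

0ₚ : Poly
0ₚ _ = + 0

1ₚ : Poly
1ₚ zero = + 1
1ₚ (suc _) = + 0

xₚ : Poly
xₚ (suc zero) = + 1
xₚ _ = + 0

_+ₚ_ : Poly → Poly → Poly
(p +ₚ q) k = p k ℤ.+ q k

_-ₚ_ : Poly → Poly → Poly
(p -ₚ q) k = p k ℤ.- q k

_·ₚ_ : ℕ → Poly → Poly
(c ·ₚ p) k = + c ℤ.* p k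

sumℤ : List ℤ → ℤ
sumℤ [] = + 0
sumℤ (z ∷ zs) = z ℤ.+ sumℤ zs

_*ₚ_ : Poly → Poly → Poly
(p *ₚ q) k = sumℤ (map (λ i → p i ℤ.* q (k ∸ i)) (upTo (suc k)))

_^ₚ_ : Poly → ℕ → Poly
p ^ₚ zero = 1ₚ
p ^ₚ suc n = p *ₚ (p ^ₚ n)

Σₚ : ℕ → (ℕ → Poly) → Poly
Σₚ zero f = 0ₚ
Σₚ (suc m) f = Σₚ m f +ₚ f (suc m)

domPoly : Graph → Poly
domPoly G k = + domCount G k

γP : (ℓ n : ℕ) → Poly
γP ℓ n = domPoly (pathPower ℓ n)

-- Read a set D of vertices of P_n^ℓ from left to right. D is dominating iff its first
-- element is among the first ℓ + 1 vertices, consecutive elements are at most 2ℓ + 1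
-- apart, and its last element is among the last ℓ + 1 vertices. A scan that keeps the
-- number of positions left before the next element is due recognises these sets, so
-- γ_k(P_n^ℓ) obeys the recursion for the number of accepted sets. Splitting off the last
-- gap gives γ_{k+2}(P_n) = Σ_{j=1}^{2ℓ+1} γ_{k+1}(P_{n-j}), which is (A3)–(A5) above
-- degree 1; subtracting this window sum at n from the one at n + 1 gives the
-- (1 + x)-recurrences (B). The coefficients of degree at most 1 come from
-- γ_0(P_n) = [n = 0] and γ_1(P_n) = min(n, 2ℓ + 2 − n).
module Submission where

open import Defs
open import Data.Bool using (Bool; true; false; T; if_then_else_)
open import Data.Bool.Properties using (T-≡)
open import Data.Empty using (⊥-elim)
open import Data.Fin using (Fin; toℕ; fromℕ<) renaming (zero to fzero; suc to fsuc)
open import Data.Fin.Properties using (¬Fin0; toℕ<n; toℕ-fromℕ<) renaming (_≟_ to _≟ᶠ_)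
open import Data.Fin.Subset using (Subset; _∈_; ∣_∣)
open import Data.Integer as ℤ using (ℤ; +_)
import Data.Integer.Properties as ℤ
open import Data.Integer.Tactic.RingSolver using (solve-∀)
open import Data.List using (List; []; _∷_; map; _++_; filter; length; applyUpTo)
open import Data.List.Properties using (filter-++; length-++; filter-≐; filter-none)
open import Data.List.Relation.Unary.All using (universal)
open import Data.Nat
open import Data.Nat.Properties
open import Data.Nat.Tactic.RingSolver using () renaming (solve-∀ to solveℕ-∀)
open import Data.Product using (∃; _×_; _,_; proj₁)
open import Data.Sum using (inj₁; inj₂)
open import Data.Vec using ([]; _∷_; here; there)
open import Function using (_∘_; _⇔_; mk⇔; Equivalence)
import Function.Properties.Equivalence as ⇔
open import Level using (0ℓ)
open import Relation.Nullary using (¬_; yes; no)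
open import Relation.Nullary.Decidable using (T?; _×-dec_)
open import Relation.Binary.PropositionalEquality
open import Relation.Unary using (Pred; Decidable; _≐_)
open import Algebra.Properties.CommutativeSemigroup +-commutativeSemigroup using (interchange)

module _ {A : Set} where

  count : {P : Pred A 0ℓ} → Decidable P → List A → ℕ
  count P? xs = length (filter P? xs)

  count-++ : {P : Pred A 0ℓ} (P? : Decidable P) (xs ys : List A) →
             count P? (xs ++ ys) ≡ count P? xs + count P? ys
  count-++ P? xs ys = trans (cong length (filter-++ P? xs ys)) (length-++ (filter P? xs))

  count-≐ : {P Q : Pred A 0ℓ} (P? : Decidable P) (Q? : Decidable Q) → P ≐ Q →
            (xs : List A) → count P? xs ≡ count Q? xs
  count-≐ P? Q? P≐Q xs = cong length (filter-≐ P? Q? P≐Q xs)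

  count-none : {P : Pred A 0ℓ} (P? : Decidable P) → (∀ x → ¬ P x) → (xs : List A) →
               count P? xs ≡ 0
  count-none P? ¬P xs = cong length (filter-none P? (universal ¬P xs))

count-map : {A B : Set} {P : Pred B 0ℓ} (P? : Decidable P) (f : A → B) (xs : List A) →
            count P? (map f xs) ≡ count (P? ∘ f) xs
count-map P? f [] = refl
count-map P? f (x ∷ xs) with P? (f x)
... | yes _ = cong suc (count-map P? f xs)
... | no _ = count-map P? f xs

-- Arithmetic, and sums ∑ T f = f 1 + ⋯ + f T indexed like Σₚ

∣m-n∣≤o⇔m≤n+o×n≤m+o : ∀ {m n o} → ∣ m - n ∣ ≤ o ⇔ (m ≤ n + o × n ≤ m + o)
∣m-n∣≤o⇔m≤n+o×n≤m+o {m} {n} {o} = mk⇔ to from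
  where
  to : ∣ m - n ∣ ≤ o → m ≤ n + o × n ≤ m + o
  to ∣m-n∣≤o = ≤-trans (m≤n+∣m-n∣ m n) (+-monoʳ-≤ n ∣m-n∣≤o)
             , ≤-trans (m≤n+∣n-m∣ n m) (+-monoʳ-≤ m ∣m-n∣≤o)
  from : m ≤ n + o × n ≤ m + o → ∣ m - n ∣ ≤ o
  from (m≤n+o , n≤m+o) with ∣m-n∣≡[m∸n]∨[n∸m] m n
  ... | inj₁ eq = subst (_≤ o) (sym eq) (m≤n+o⇒m∸n≤o m n m≤n+o)
  ... | inj₂ eq = subst (_≤ o) (sym eq) (m≤n+o⇒m∸n≤o n m n≤m+o)

m∸n+[1∸[n∸m]]≡1+m∸n : ∀ m n → m ∸ n + (1 ∸ (n ∸ m)) ≡ suc m ∸ n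
m∸n+[1∸[n∸m]]≡1+m∸n zero zero = refl
m∸n+[1∸[n∸m]]≡1+m∸n zero (suc n) = refl
m∸n+[1∸[n∸m]]≡1+m∸n (suc m) zero = +-comm (suc m) 1
m∸n+[1∸[n∸m]]≡1+m∸n (suc m) (suc n) = m∸n+[1∸[n∸m]]≡1+m∸n m n

2n+1≡n+[1+n] : ∀ n → 2 * n + 1 ≡ n + suc n
2n+1≡n+[1+n] = solveℕ-∀

2n+2≡1+n+[1+n] : ∀ n → 2 * n + 2 ≡ suc (n + suc n)
2n+2≡1+n+[1+n] = solveℕ-∀

2[n+1]≡1+n+[1+n] : ∀ n → 2 * (n + 1) ≡ suc (n + suc n)
2[n+1]≡1+n+[1+n] = solveℕ-∀

∑ : ℕ → (ℕ → ℕ) → ℕ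
∑ zero f = 0
∑ (suc T) f = ∑ T f + f (suc T)

∑-cong : ∀ T {f g : ℕ → ℕ} → (∀ j → f (suc j) ≡ g (suc j)) → ∑ T f ≡ ∑ T g
∑-cong zero f≗g = refl
∑-cong (suc T) f≗g = cong₂ _+_ (∑-cong T f≗g) (f≗g T)

∑-zero : ∀ T {f : ℕ → ℕ} → (∀ j → f (suc j) ≡ 0) → ∑ T f ≡ 0
∑-zero zero f≗0 = refl
∑-zero (suc T) f≗0 = cong₂ _+_ (∑-zero T f≗0) (f≗0 T)

∑-+ : ∀ T (f g : ℕ → ℕ) → ∑ T (λ j → f j + g j) ≡ ∑ T f + ∑ T g
∑-+ zero f g = refl
∑-+ (suc T) f g =
  trans (cong (_+ (f (suc T) + g (suc T))) (∑-+ T f g)) (interchange (∑ T f) (∑ T g) _ _)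

∑-suc : ∀ T (f : ℕ → ℕ) → ∑ (suc T) f ≡ f 1 + ∑ T (f ∘ suc)
∑-suc zero f = +-comm 0 (f 1)
∑-suc (suc T) f = trans (cong (_+ f (2 + T)) (∑-suc T f)) (+-assoc (f 1) _ _)

∑-extend : ∀ {M} T (f : ℕ → ℕ) → M ≤ T → (∀ j → M < j → f j ≡ 0) → ∑ T f ≡ ∑ M f
∑-extend T f M≤T f>M≡0 with m≤n⇒m<n∨m≡n M≤T
... | inj₂ refl = refl
∑-extend (suc T) f _ f>M≡0 | inj₁ M<1+T =
  trans (cong₂ _+_ (∑-extend T f (s≤s⁻¹ M<1+T) f>M≡0) (f>M≡0 (suc T) M<1+T)) (+-identityʳ _)

∑-slide : ∀ T n (f : ℕ → ℕ) →
          ∑ T (λ j → f (suc n ∸ j)) + f (n ∸ T) ≡ f n + ∑ T (λ j → f (n ∸ j))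
∑-slide zero n f = +-comm 0 (f n)
∑-slide (suc T) n f = begin
    ∑ T (λ j → f (suc n ∸ j)) + f (n ∸ T) + f (n ∸ suc T)
  ≡⟨ cong (_+ f (n ∸ suc T)) (∑-slide T n f) ⟩
    f n + ∑ T (λ j → f (n ∸ j)) + f (n ∸ suc T)
  ≡⟨ +-assoc (f n) _ _ ⟩
    f n + ∑ (suc T) (λ j → f (n ∸ j))
  ∎
  where open ≡-Reasoning

-- Polynomial coefficients

sumℤ-zeros : ∀ (h : ℕ → ℤ) f n → (∀ i → h (f i) ≡ + 0) → sumℤ (map h (applyUpTo f n)) ≡ + 0
sumℤ-zeros h f zero h∘f≗0 = refl
sumℤ-zeros h f (suc n) h∘f≗0 = cong₂ ℤ._+_ (h∘f≗0 0) (sumℤ-zeros h (f ∘ suc) n (h∘f≗0 ∘ suc))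

*ₚ-zero : ∀ p q → (p *ₚ q) 0 ≡ p 0 ℤ.* q 0
*ₚ-zero p q = ℤ.+-identityʳ _

*ₚ-linear-suc : ∀ p q → (∀ i → p (2 + i) ≡ + 0) →
                ∀ k → (p *ₚ q) (suc k) ≡ p 0 ℤ.* q (suc k) ℤ.+ p 1 ℤ.* q k
*ₚ-linear-suc p q deg≤1 k = cong (ℤ._+_ (p 0 ℤ.* q (suc k)))
  (trans (cong (ℤ._+_ (p 1 ℤ.* q k)) (sumℤ-zeros _ (suc ∘ suc) k (λ i → cong (ℤ._* _) (deg≤1 i))))
         (ℤ.+-identityʳ _))

x*ₚ-zero : ∀ q → (xₚ *ₚ q) 0 ≡ + 0
x*ₚ-zero q = *ₚ-zero xₚ q

x*ₚ-suc : ∀ q k → (xₚ *ₚ q) (suc k) ≡ q k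
x*ₚ-suc q k = trans (*ₚ-linear-suc xₚ q (λ _ → refl) k) (trans (ℤ.+-identityˡ _) (ℤ.*-identityˡ (q k)))

[1+x]*ₚ-zero : ∀ q → ((1ₚ +ₚ xₚ) *ₚ q) 0 ≡ q 0
[1+x]*ₚ-zero q = trans (*ₚ-zero (1ₚ +ₚ xₚ) q) (ℤ.*-identityˡ (q 0))

[1+x]*ₚ-suc : ∀ q k → ((1ₚ +ₚ xₚ) *ₚ q) (suc k) ≡ q (suc k) ℤ.+ q k
[1+x]*ₚ-suc q k = trans (*ₚ-linear-suc (1ₚ +ₚ xₚ) q (λ _ → refl) k)
                        (cong₂ ℤ._+_ (ℤ.*-identityˡ (q (suc k))) (ℤ.*-identityˡ (q k)))

x*ₚ1ₚ : ∀ {q} → q ≈ₚ 1ₚ → xₚ *ₚ q ≈ₚ xₚ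
x*ₚ1ₚ {q} q≈1 zero = x*ₚ-zero q
x*ₚ1ₚ {q} q≈1 (suc zero) = trans (x*ₚ-suc q 0) (q≈1 0)
x*ₚ1ₚ {q} q≈1 (suc (suc k)) = trans (x*ₚ-suc q (suc k)) (q≈1 (suc k))

x≈[1+x]*1-1 : xₚ ≈ₚ (1ₚ +ₚ xₚ) *ₚ 1ₚ -ₚ 1ₚ
x≈[1+x]*1-1 zero = sym (cong (ℤ._- + 1) ([1+x]*ₚ-zero 1ₚ))
x≈[1+x]*1-1 (suc zero) = sym (cong (ℤ._- + 0) ([1+x]*ₚ-suc 1ₚ 0))
x≈[1+x]*1-1 (suc (suc k)) = sym (cong (ℤ._- + 0) ([1+x]*ₚ-suc 1ₚ (suc k)))

[1+x]*[p-1]+x : ∀ p {q} → q ≈ₚ p -ₚ 1ₚ →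
                (1ₚ +ₚ xₚ) *ₚ q +ₚ xₚ ≈ₚ (1ₚ +ₚ xₚ) *ₚ p -ₚ 1ₚ
[1+x]*[p-1]+x p {q} q≈p-1 zero
  rewrite [1+x]*ₚ-zero q | [1+x]*ₚ-zero p | q≈p-1 0 = ℤ.+-identityʳ _
[1+x]*[p-1]+x p {q} q≈p-1 (suc zero)
  rewrite [1+x]*ₚ-suc q 0 | [1+x]*ₚ-suc p 0 | q≈p-1 1 | q≈p-1 0 = lemma (p 1) (p 0)
  where
  lemma : ∀ a b → a ℤ.- + 0 ℤ.+ (b ℤ.- + 1) ℤ.+ + 1 ≡ a ℤ.+ b ℤ.- + 0
  lemma = solve-∀
[1+x]*[p-1]+x p {q} q≈p-1 (suc (suc k))
  rewrite [1+x]*ₚ-suc q (suc k) | [1+x]*ₚ-suc p (suc k) | q≈p-1 (2 + k) | q≈p-1 (suc k) =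
  lemma (p (2 + k)) (p (suc k))
  where
  lemma : ∀ a b → a ℤ.- + 0 ℤ.+ (b ℤ.- + 0) ℤ.+ + 0 ≡ a ℤ.+ b ℤ.- + 0
  lemma = solve-∀

Σₚ-coeff : ∀ M (f : ℕ → ℕ → ℕ) k → Σₚ M (λ j i → + f j i) k ≡ + ∑ M (λ j → f j k)
Σₚ-coeff zero f k = refl
Σₚ-coeff (suc M) f k = cong (ℤ._+ + f (suc M) k) (Σₚ-coeff M f k)

+ₚ⇒-ₚ : ∀ {p q r} → p +ₚ q ≈ₚ r → p ≈ₚ r -ₚ q
+ₚ⇒-ₚ {p} {q} p+q≈r k = trans (sym (m+n-n≡m (p k) (q k))) (cong (ℤ._- q k) (p+q≈r k))
  where
  m+n-n≡m : ∀ m n → m ℤ.+ n ℤ.- n ≡ m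
  m+n-n≡m = solve-∀

module PathPower (ℓ : ℕ) where

  maxGap : ℕ
  maxGap = ℓ + suc ℓ

  -- Dominating sets are the sets accepted by a scan

  -- The next element of D must occur within the next s positions. At the end, a budget
  -- above ℓ means that the last element is within distance ℓ of the last vertex.
  scan : ℕ → {m : ℕ} → Subset m → Bool
  scan s [] = ℓ <ᵇ s
  scan zero (_ ∷ _) = false
  scan (suc s) (false ∷ D) = scan s D
  scan (suc s) (true ∷ D) = scan maxGap D

  _covers_ : ℕ → ℕ → Set
  u covers w = u < w × w ≤ u + maxGap

  -- Position w stands for vertex w − (ℓ + 1). Positions below ℓ + 1 are virtual vertices
  -- to the left of the path, which must also be dominated when s ≤ ℓ.
  DominatesFrom : ℕ → {m : ℕ} → Subset m → Set
  DominatesFrom s {m} D = ∀ w → s ≤ w → w < m + suc ℓ → ∃ λ u → u ∈ D × toℕ u covers w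

  dominatesFrom-[] : ∀ {s} → DominatesFrom s [] ⇔ ℓ < s
  dominatesFrom-[] {s} = mk⇔ to from
    where
    to : DominatesFrom s [] → ℓ < s
    to dom = ≰⇒> λ s≤ℓ → ¬Fin0 (proj₁ (dom s ≤-refl (s≤s s≤ℓ)))
    from : ℓ < s → DominatesFrom s []
    from ℓ<s w s≤w w<1+ℓ = ⊥-elim (<⇒≱ ℓ<s (≤-trans s≤w (s≤s⁻¹ w<1+ℓ)))

  dominatesFrom-zero : ∀ {m b} {D : Subset m} → ¬ DominatesFrom 0 (b ∷ D)
  dominatesFrom-zero dom with dom 0 z≤n z<s
  ... | _ , _ , () , _

  dominatesFrom-false : ∀ {s m} {D : Subset m} → DominatesFrom (suc s) (false ∷ D) ⇔ DominatesFrom s D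
  dominatesFrom-false {s} {m} {D} = mk⇔ to from
    where
    to : DominatesFrom (suc s) (false ∷ D) → DominatesFrom s D
    to dom w s≤w w< with dom (suc w) (s≤s s≤w) (s≤s w<)
    ... | fsuc u , there u∈D , u<w , w≤u+g = u , u∈D , s≤s⁻¹ u<w , s≤s⁻¹ w≤u+g
    from : DominatesFrom s D → DominatesFrom (suc s) (false ∷ D)
    from dom (suc w) (s≤s s≤w) (s≤s w<) with dom w s≤w w<
    ... | u , u∈D , u<w , w≤u+g = fsuc u , there u∈D , s≤s u<w , s≤s w≤u+g

  dominatesFrom-true : ∀ {s m} {D : Subset m} → s < maxGap →
                       DominatesFrom (suc s) (true ∷ D) ⇔ DominatesFrom maxGap D
  dominatesFrom-true {s} {m} {D} s<g = mk⇔ to from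
    where
    to : DominatesFrom (suc s) (true ∷ D) → DominatesFrom maxGap D
    to dom w g≤w w< with dom (suc w) (s≤s (≤-trans (<⇒≤ s<g) g≤w)) (s≤s w<)
    ... | fzero , _ , _ , w<g = ⊥-elim (<⇒≱ w<g g≤w)
    ... | fsuc u , there u∈D , u<w , w≤u+g = u , u∈D , s≤s⁻¹ u<w , s≤s⁻¹ w≤u+g
    from : DominatesFrom maxGap D → DominatesFrom (suc s) (true ∷ D)
    from dom w s<w w< with w ≤? maxGap
    ... | yes w≤g = fzero , here , <-≤-trans z<s s<w , w≤g
    from dom (suc w) _ (s≤s w<) | no w≰g with dom w (s≤s⁻¹ (≰⇒> w≰g)) w<
    ... | u , u∈D , u<w , w≤u+g = fsuc u , there u∈D , s≤s u<w , s≤s w≤u+g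

  scan-correct : ∀ {s m} (D : Subset m) → s ≤ maxGap → T (scan s D) ⇔ DominatesFrom s D
  scan-correct [] _ = ⇔.trans (mk⇔ (<ᵇ⇒< _ _) <⇒<ᵇ) (⇔.sym dominatesFrom-[])
  scan-correct {zero} (_ ∷ _) _ = mk⇔ (λ ()) (⊥-elim ∘ dominatesFrom-zero)
  scan-correct {suc s} (false ∷ D) s<g =
    ⇔.trans (scan-correct D (<⇒≤ s<g)) (⇔.sym dominatesFrom-false)
  scan-correct {suc s} (true ∷ D) s<g =
    ⇔.trans (scan-correct D ≤-refl) (⇔.sym (dominatesFrom-true s<g))

  covers⇔near : ∀ {u v} → u covers (v + suc ℓ) ⇔ ∣ u - v ∣ ≤ ℓ
  covers⇔near {u} {v} = ⇔.trans (mk⇔ to from) (⇔.sym ∣m-n∣≤o⇔m≤n+o×n≤m+o)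
    where
    u+g≡u+ℓ+1+ℓ : u + maxGap ≡ u + ℓ + suc ℓ
    u+g≡u+ℓ+1+ℓ = sym (+-assoc u ℓ (suc ℓ))
    to : u covers (v + suc ℓ) → u ≤ v + ℓ × v ≤ u + ℓ
    to (u< , ≤u+g) = s≤s⁻¹ (subst (u <_) (+-suc v ℓ) u<)
                   , +-cancelʳ-≤ (suc ℓ) v (u + ℓ) (subst (v + suc ℓ ≤_) u+g≡u+ℓ+1+ℓ ≤u+g)
    from : u ≤ v + ℓ × v ≤ u + ℓ → u covers (v + suc ℓ)
    from (u≤ , v≤) = subst (u <_) (sym (+-suc v ℓ)) (s≤s u≤)
                   , subst (v + suc ℓ ≤_) (sym u+g≡u+ℓ+1+ℓ) (+-monoˡ-≤ (suc ℓ) v≤)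

  Near : ∀ {m} → Subset m → Set
  Near {m} D = ∀ (v : Fin m) → ∃ λ u → u ∈ D × ∣ toℕ u - toℕ v ∣ ≤ ℓ

  dominating⇔near : ∀ {m} {D : Subset m} → Dominating (pathPower ℓ m) D ⇔ Near D
  dominating⇔near {m} {D} = mk⇔ to from
    where
    to : Dominating (pathPower ℓ m) D → Near D
    to dom v with dom v
    ... | inj₁ v∈D = v , v∈D , subst (_≤ ℓ) (sym (∣n-n∣≡0 (toℕ v))) z≤n
    ... | inj₂ (u , u∈D , _ , near) = u , u∈D , near
    from : Near D → Dominating (pathPower ℓ m) D
    from near v with near v
    ... | u , u∈D , d with u ≟ᶠ v
    ... | yes refl = inj₁ u∈D
    ... | no u≢v = inj₂ (u , u∈D , u≢v , d)

  near⇔dominatesFrom : ∀ {m} {D : Subset m} → Near D ⇔ DominatesFrom (suc ℓ) D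
  near⇔dominatesFrom {m} {D} = mk⇔ to from
    where
    Covered : ℕ → Set
    Covered w = ∃ λ u → u ∈ D × toℕ u covers w
    to : Near D → DominatesFrom (suc ℓ) D
    to near w ℓ<w w< = subst Covered v+1+ℓ≡w (covered (near v))
      where
      v<m : w ∸ suc ℓ < m
      v<m = +-cancelʳ-< (suc ℓ) (w ∸ suc ℓ) m (subst (_< m + suc ℓ) (sym (m∸n+n≡m ℓ<w)) w<)
      v : Fin m
      v = fromℕ< v<m
      v+1+ℓ≡w : toℕ v + suc ℓ ≡ w
      v+1+ℓ≡w = trans (cong (_+ suc ℓ) (toℕ-fromℕ< v<m)) (m∸n+n≡m ℓ<w)
      covered : (∃ λ u → u ∈ D × ∣ toℕ u - toℕ v ∣ ≤ ℓ) → Covered (toℕ v + suc ℓ)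
      covered (u , u∈D , d) = u , u∈D , Equivalence.from covers⇔near d
    from : DominatesFrom (suc ℓ) D → Near D
    from dom v with dom (toℕ v + suc ℓ) (m≤n+m (suc ℓ) (toℕ v)) (+-monoˡ-< (suc ℓ) (toℕ<n v))
    ... | u , u∈D , u-covers = u , u∈D , Equivalence.to covers⇔near u-covers

  dominating⇔scan : ∀ {m} (D : Subset m) → Dominating (pathPower ℓ m) D ⇔ T (scan (suc ℓ) D)
  dominating⇔scan D = ⇔.trans dominating⇔near
    (⇔.trans near⇔dominatesFrom (⇔.sym (scan-correct D (m≤n+m (suc ℓ) ℓ))))

  -- Counting accepted sets

  #accepted : ℕ → ℕ → ℕ → ℕ
  #accepted s zero zero = if ℓ <ᵇ s then 1 else 0
  #accepted s zero (suc k) = 0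
  #accepted zero (suc m) k = 0
  #accepted (suc s) (suc m) zero = #accepted s m zero
  #accepted (suc s) (suc m) (suc k) = #accepted s m (suc k) + #accepted maxGap m k

  Accepted : ℕ → ℕ → {m : ℕ} → Pred (Subset m) 0ℓ
  Accepted s k D = T (scan s D) × ∣ D ∣ ≡ k

  accepted? : ∀ s k {m} → Decidable (Accepted s k {m})
  accepted? s k D = T? (scan s D) ×-dec (∣ D ∣ ≟ k)

  count-accepted : ∀ s m k → count (accepted? s k) (allSubsets m) ≡ #accepted s m k
  count-accepted s zero zero with ℓ <ᵇ s
  ... | true = refl
  ... | false = refl
  count-accepted s zero (suc k) with ℓ <ᵇ s
  ... | true = refl
  ... | false = refl
  count-accepted zero (suc m) k =
    count-none (accepted? zero k) (λ { (_ ∷ _) (() , _) }) (allSubsets (suc m))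
  count-accepted (suc s) (suc m) k = begin
      count (accepted? (suc s) k) (map (false ∷_) A ++ map (true ∷_) A)
    ≡⟨ count-++ (accepted? (suc s) k) (map (false ∷_) A) (map (true ∷_) A) ⟩
      count (accepted? (suc s) k) (map (false ∷_) A) + count (accepted? (suc s) k) (map (true ∷_) A)
    ≡⟨ cong₂ _+_ (count-map (accepted? (suc s) k) (false ∷_) A)
                 (count-map (accepted? (suc s) k) (true ∷_) A) ⟩
      count (accepted? s k) A + count (accepted? (suc s) k ∘ (true ∷_)) A
    ≡⟨ by-head k ⟩
      #accepted (suc s) (suc m) k
    ∎
    where
    open ≡-Reasoning
    A = allSubsets m
    by-head : ∀ k → count (accepted? s k) A + count (accepted? (suc s) k ∘ (true ∷_)) A
                    ≡ #accepted (suc s) (suc m) k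
    by-head zero =
      trans (cong₂ _+_ (count-accepted s m zero) (count-none _ (λ { _ (_ , ()) }) A)) (+-identityʳ _)
    by-head (suc k) = cong₂ _+_ (count-accepted s m (suc k))
      (trans (count-≐ _ (accepted? maxGap k)
                      ((λ (a , e) → a , suc-injective e) , (λ (a , e) → a , cong suc e)) A)
             (count-accepted maxGap m k))

  domCount≡#accepted : ∀ m k → domCount (pathPower ℓ m) k ≡ #accepted (suc ℓ) m k
  domCount≡#accepted m k =
    trans (count-≐ _ (accepted? (suc ℓ) k) dominating-of-size⇔accepted (allSubsets m))
          (count-accepted (suc ℓ) m k)
    where
    dominating-of-size⇔accepted :
      (λ D → Dominating (pathPower ℓ m) D × ∣ D ∣ ≡ k) ≐ Accepted (suc ℓ) k
    dominating-of-size⇔accepted = (λ (d , e) → Equivalence.to (dominating⇔scan _) d , e)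
                                , (λ (a , e) → Equivalence.from (dominating⇔scan _) a , e)

  #accepted-∅≡1 : ∀ s m → m + ℓ < s → #accepted s m 0 ≡ 1
  #accepted-∅≡1 s zero ℓ<s rewrite Equivalence.to T-≡ (<⇒<ᵇ ℓ<s) = refl
  #accepted-∅≡1 (suc s) (suc m) (s≤s m+ℓ<s) = #accepted-∅≡1 s m m+ℓ<s

  #accepted-∅≡0 : ∀ s m → s ≤ m + ℓ → #accepted s m 0 ≡ 0
  #accepted-∅≡0 s zero s≤ℓ with ℓ <ᵇ s in ℓ<ᵇs
  ... | false = refl
  ... | true = ⊥-elim (<⇒≱ (<ᵇ⇒< ℓ s (subst T (sym ℓ<ᵇs) _)) s≤ℓ)
  #accepted-∅≡0 zero (suc m) _ = refl
  #accepted-∅≡0 (suc s) (suc m) (s≤s s≤m+ℓ) = #accepted-∅≡0 s m s≤m+ℓ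

  #accepted-1 : ∀ s m → #accepted s m 1 ≡ (s ⊓ m) ∸ (m ∸ suc ℓ)
  #accepted-1 s zero = sym (⊓-zeroʳ s)
  #accepted-1 zero (suc m) = sym (0∸n≡0 (m ∸ ℓ))
  #accepted-1 (suc s) (suc m) with m ≤? ℓ
  ... | yes m≤ℓ
    rewrite #accepted-1 s m
          | #accepted-∅≡1 maxGap m (+-mono-≤-< m≤ℓ (n<1+n ℓ))
          | m≤n⇒m∸n≡0 m≤ℓ | m≤n⇒m∸n≡0 (m≤n⇒m≤1+n m≤ℓ) = +-comm (s ⊓ m) 1
  ... | no m≰ℓ
    rewrite #accepted-1 s m
          | #accepted-∅≡0 maxGap m (subst (_≤ m + ℓ) (+-comm (suc ℓ) ℓ) (+-monoˡ-≤ ℓ (≰⇒> m≰ℓ)))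
          | +-∸-assoc 1 (≰⇒> m≰ℓ) = +-identityʳ _

  #accepted-zero-budget : ∀ m k → #accepted 0 m (suc k) ≡ 0
  #accepted-zero-budget zero k = refl
  #accepted-zero-budget (suc m) k = refl

  -- g (m − j), and 0 (not g 0, as with m ∸ j) when j > m
  guarded : (ℕ → ℕ) → ℕ → ℕ → ℕ
  guarded g m zero = g m
  guarded g zero (suc j) = 0
  guarded g (suc m) (suc j) = guarded g m j

  -- The first element is at position j − 1.
  #accepted-first : ∀ t m k → #accepted t m (suc k) ≡ ∑ t (guarded (λ r → #accepted maxGap r k) m)
  #accepted-first zero m k = #accepted-zero-budget m k
  #accepted-first (suc t) zero k = sym (∑-zero (suc t) (λ _ → refl))
  #accepted-first (suc t) (suc m) k =
    trans (cong (_+ #accepted maxGap m k) (#accepted-first t m k))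
          (trans (+-comm _ (#accepted maxGap m k))
                 (sym (∑-suc t (guarded (λ r → #accepted maxGap r k) (suc m)))))

  -- j is the gap between the last two elements.
  #accepted-gap : ∀ s m k → #accepted s m (2 + k) ≡ ∑ maxGap (λ j → #accepted s (m ∸ j) (suc k))
  #accepted-gap zero m k =
    trans (#accepted-zero-budget m (suc k)) (sym (∑-zero maxGap (λ j → #accepted-zero-budget (m ∸ suc j) k)))
  #accepted-gap (suc s) zero k = sym (∑-zero maxGap (λ _ → refl))
  #accepted-gap (suc s) (suc m) k = begin
      #accepted s m (2 + k) + #accepted maxGap m (suc k)
    ≡⟨ cong₂ _+_ (#accepted-gap s m k) (#accepted-first maxGap m k) ⟩
      ∑ maxGap (λ j → #accepted s (m ∸ j) (suc k)) + ∑ maxGap (guarded g m)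
    ≡⟨ ∑-+ maxGap (λ j → #accepted s (m ∸ j) (suc k)) (guarded g m) ⟨
      ∑ maxGap (λ j → #accepted s (m ∸ j) (suc k) + guarded g m j)
    ≡⟨ ∑-cong maxGap (split m) ⟩
      ∑ maxGap (λ j → #accepted (suc s) (suc m ∸ j) (suc k))
    ∎
    where
    open ≡-Reasoning
    g : ℕ → ℕ
    g r = #accepted maxGap r k
    split : ∀ m j →
            #accepted s (m ∸ suc j) (suc k) + guarded g m (suc j) ≡ #accepted (suc s) (m ∸ j) (suc k)
    split zero zero = refl
    split zero (suc j) = refl
    split (suc m) zero = refl
    split (suc m) (suc j) = split m j

  -- The coefficients γ_k(P_n^ℓ) and the polynomials γ(P_n^ℓ, x)

  #dom : ℕ → ℕ → ℕ
  #dom n k = domCount (pathPower ℓ n) k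

  #dom-suc-0 : ∀ n → #dom (suc n) 0 ≡ 0
  #dom-suc-0 n = trans (domCount≡#accepted (suc n) 0) (#accepted-∅≡0 (suc ℓ) (suc n) (s≤s (m≤n+m ℓ n)))

  #dom-0≡0 : ∀ {n} → 1 ≤ n → #dom n 0 ≡ 0
  #dom-0≡0 {suc n} _ = #dom-suc-0 n

  #dom-0 : ∀ n → #dom n 0 ≡ 1 ∸ n
  #dom-0 zero = trans (domCount≡#accepted 0 0) (#accepted-∅≡1 (suc ℓ) 0 ≤-refl)
  #dom-0 (suc n) = trans (#dom-suc-0 n) (sym (0∸n≡0 n))

  #dom-empty-graph : ∀ k → #dom 0 (suc k) ≡ 0
  #dom-empty-graph k = domCount≡#accepted 0 (suc k)

  #dom-1-≤ : ∀ {n} → n ≤ suc ℓ → #dom n 1 ≡ n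
  #dom-1-≤ {n} n≤1+ℓ rewrite domCount≡#accepted n 1 | #accepted-1 (suc ℓ) n
                            | m≥n⇒m⊓n≡n n≤1+ℓ | m≤n⇒m∸n≡0 n≤1+ℓ = refl

  #dom-1-≥ : ∀ {n} → suc ℓ ≤ n → #dom n 1 ≡ suc maxGap ∸ n
  #dom-1-≥ {n} 1+ℓ≤n rewrite domCount≡#accepted n 1 | #accepted-1 (suc ℓ) n | m≤n⇒m⊓n≡m 1+ℓ≤n =
    begin
      suc ℓ ∸ (n ∸ suc ℓ)
    ≡⟨ [m+n]∸[m+o]≡n∸o (suc ℓ) (suc ℓ) (n ∸ suc ℓ) ⟨
      suc ℓ + suc ℓ ∸ (suc ℓ + (n ∸ suc ℓ))
    ≡⟨ cong (suc ℓ + suc ℓ ∸_) (m+[n∸m]≡n 1+ℓ≤n) ⟩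
      suc ℓ + suc ℓ ∸ n
    ∎
    where open ≡-Reasoning

  ∑-#dom-0 : ∀ T {n} → 1 ≤ n → ∑ T (λ j → #dom (n ∸ j) 0) ≡ suc T ∸ n
  ∑-#dom-0 zero {suc n} _ = sym (0∸n≡0 n)
  ∑-#dom-0 (suc T) {n} 1≤n = begin
      ∑ T (λ j → #dom (n ∸ j) 0) + #dom (n ∸ suc T) 0
    ≡⟨ cong₂ _+_ (∑-#dom-0 T 1≤n) (#dom-0 (n ∸ suc T)) ⟩
      suc T ∸ n + (1 ∸ (n ∸ suc T))
    ≡⟨ m∸n+[1∸[n∸m]]≡1+m∸n (suc T) n ⟩
      suc (suc T) ∸ n
    ∎
    where open ≡-Reasoning

  #dom-gap : ∀ n k → #dom n (2 + k) ≡ ∑ maxGap (λ j → #dom (n ∸ j) (suc k))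
  #dom-gap n k = trans (domCount≡#accepted n (2 + k))
    (trans (#accepted-gap (suc ℓ) n k)
           (∑-cong maxGap (λ j → sym (domCount≡#accepted (n ∸ suc j) (suc k)))))

  #dom-gap-short : ∀ {n} k → n ≤ maxGap → #dom (suc n) (2 + k) ≡ ∑ n (λ j → #dom (suc n ∸ j) (suc k))
  #dom-gap-short {n} k n≤g = trans (#dom-gap (suc n) k) (∑-extend maxGap _ n≤g vanish)
    where
    vanish : ∀ j → n < j → #dom (suc n ∸ j) (suc k) ≡ 0
    vanish j n<j = trans (cong (λ r → #dom r (suc k)) (m≤n⇒m∸n≡0 n<j)) (#dom-empty-graph k)

  #dom-pascal : ∀ n k → #dom (suc n) (2 + k) + #dom (n ∸ maxGap) (suc k) ≡ #dom n (2 + k) + #dom n (suc k)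
  #dom-pascal n k = begin
      #dom (suc n) (2 + k) + f (n ∸ maxGap)
    ≡⟨ cong (_+ f (n ∸ maxGap)) (#dom-gap (suc n) k) ⟩
      ∑ maxGap (λ j → f (suc n ∸ j)) + f (n ∸ maxGap)
    ≡⟨ ∑-slide maxGap n f ⟩
      f n + ∑ maxGap (λ j → f (n ∸ j))
    ≡⟨ cong (_+_ (f n)) (#dom-gap n k) ⟨
      f n + #dom n (2 + k)
    ≡⟨ +-comm (f n) _ ⟩
      #dom n (2 + k) + f n
    ∎
    where
    open ≡-Reasoning
    f : ℕ → ℕ
    f r = #dom r (suc k)

  #dom-pascal-short : ∀ {n} → n ≤ ℓ → ∀ k → #dom (suc n) (2 + k) ≡ #dom n (2 + k) + #dom n (suc k)
  #dom-pascal-short {n} n≤ℓ k =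
    trans (sym (+-identityʳ _)) (trans (cong (_+_ (#dom (suc n) (2 + k))) (sym vanish)) (#dom-pascal n k))
    where
    vanish : #dom (n ∸ maxGap) (suc k) ≡ 0
    vanish = trans (cong (λ r → #dom r (suc k)) (m≤n⇒m∸n≡0 (≤-trans n≤ℓ (m≤m+n ℓ (suc ℓ)))))
                   (#dom-empty-graph k)

  #dom-recurrence : ∀ {n} → suc ℓ ≤ n → ∀ k →
                    #dom (suc n) (suc k) + #dom (n ∸ maxGap) k ≡ #dom n (suc k) + #dom n k
  #dom-recurrence {n} 1+ℓ≤n zero
    rewrite #dom-1-≥ (m≤n⇒m≤1+n 1+ℓ≤n) | #dom-0 (n ∸ maxGap) | #dom-1-≥ 1+ℓ≤n
          | #dom-0≡0 (≤-trans (s≤s z≤n) 1+ℓ≤n) =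
    trans (m∸n+[1∸[n∸m]]≡1+m∸n maxGap n) (sym (+-identityʳ _))
  #dom-recurrence {n} _ (suc k) = #dom-pascal n k

  γ-0 : γP ℓ 0 ≈ₚ 1ₚ
  γ-0 zero = cong +_ (#dom-0 0)
  γ-0 (suc k) = cong +_ (#dom-empty-graph k)

  γ-1 : γP ℓ 1 ≈ₚ xₚ
  γ-1 zero = cong +_ (#dom-suc-0 0)
  γ-1 (suc zero) = cong +_ (#dom-1-≤ (s≤s z≤n))
  γ-1 (suc (suc k)) = cong +_ (#dom-gap-short k z≤n)

  γ-gap-form : ∀ {n} a M → 1 ≤ n →
    #dom n 1 ≡ a + ∑ M (λ j → #dom (n ∸ j) 0) →
    (∀ k → #dom n (2 + k) ≡ ∑ M (λ j → #dom (n ∸ j) (suc k))) →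
    γP ℓ n ≈ₚ a ·ₚ xₚ +ₚ xₚ *ₚ Σₚ M (λ j → γP ℓ (n ∸ j))
  γ-gap-form {n} a M 1≤n deg1 deg≥2 = coeff
    where
    S : Poly
    S = Σₚ M (λ j → γP ℓ (n ∸ j))
    x*S-coeff : ∀ k → (xₚ *ₚ S) (suc k) ≡ + ∑ M (λ j → #dom (n ∸ j) k)
    x*S-coeff k = trans (x*ₚ-suc S k) (Σₚ-coeff M (λ j → #dom (n ∸ j)) k)
    coeff : γP ℓ n ≈ₚ a ·ₚ xₚ +ₚ xₚ *ₚ S
    coeff zero = trans (cong +_ (#dom-0≡0 1≤n)) (sym (cong₂ ℤ._+_ (ℤ.*-zeroʳ (+ a)) (x*ₚ-zero S)))
    coeff (suc zero) = trans (cong +_ deg1) (sym (cong₂ ℤ._+_ (ℤ.*-identityʳ (+ a)) (x*S-coeff 0)))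
    coeff (suc (suc k)) = trans (cong +_ (deg≥2 k)) (sym (cong₂ ℤ._+_ (ℤ.*-zeroʳ (+ a)) (x*S-coeff (suc k))))

  γ-gap-short : ∀ {n a} → 1 ≤ n → n ≤ suc maxGap → #dom n 1 ≡ a →
                γP ℓ n ≈ₚ a ·ₚ xₚ +ₚ xₚ *ₚ Σₚ (n ∸ 1) (λ j → γP ℓ (n ∸ j))
  γ-gap-short {suc n} {a} _ (s≤s n≤g) #dom≡a = γ-gap-form a n (s≤s z≤n) deg1 (λ k → #dom-gap-short k n≤g)
    where
    deg1 : #dom (suc n) 1 ≡ a + ∑ n (λ j → #dom (suc n ∸ j) 0)
    deg1 rewrite ∑-#dom-0 n {suc n} (s≤s z≤n) | n∸n≡0 n | +-identityʳ a = #dom≡a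

  γ-gap-long : ∀ {n} → maxGap ≤ n → γP ℓ n ≈ₚ xₚ *ₚ Σₚ maxGap (λ j → γP ℓ (n ∸ j))
  γ-gap-long {n} g≤n k = trans (γ-gap-form 0 maxGap 1≤n deg1 (#dom-gap n) k) (ℤ.+-identityˡ _)
    where
    1+ℓ≤n : suc ℓ ≤ n
    1+ℓ≤n = ≤-trans (m≤n+m (suc ℓ) ℓ) g≤n
    1≤n : 1 ≤ n
    1≤n = ≤-trans (s≤s z≤n) 1+ℓ≤n
    deg1 : #dom n 1 ≡ ∑ maxGap (λ j → #dom (n ∸ j) 0)
    deg1 = trans (#dom-1-≥ 1+ℓ≤n) (sym (∑-#dom-0 maxGap 1≤n))

  γ-recurrence : ∀ {n} → suc ℓ ≤ n →
                 γP ℓ (suc n) +ₚ xₚ *ₚ γP ℓ (n ∸ maxGap) ≈ₚ (1ₚ +ₚ xₚ) *ₚ γP ℓ n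
  γ-recurrence {n} 1+ℓ≤n zero =
    trans (cong₂ ℤ._+_ (cong +_ (#dom-suc-0 n)) (x*ₚ-zero (γP ℓ (n ∸ maxGap))))
          (sym (trans ([1+x]*ₚ-zero (γP ℓ n)) (cong +_ (#dom-0≡0 (≤-trans (s≤s z≤n) 1+ℓ≤n)))))
  γ-recurrence {n} 1+ℓ≤n (suc k) =
    trans (cong (ℤ._+_ (γP ℓ (suc n) (suc k))) (x*ₚ-suc (γP ℓ (n ∸ maxGap)) k))
          (trans (cong +_ (#dom-recurrence 1+ℓ≤n k)) (sym ([1+x]*ₚ-suc (γP ℓ n) k)))

  γ-recurrence-middle : ∀ {n} → suc (suc ℓ) ≤ n → n ≤ suc maxGap →
                        γP ℓ n ≈ₚ (1ₚ +ₚ xₚ) *ₚ γP ℓ (n ∸ 1) -ₚ xₚ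
  γ-recurrence-middle {suc n} (s≤s 1+ℓ≤n) (s≤s n≤g) = +ₚ⇒-ₚ λ k →
    trans (cong (ℤ._+_ (γP ℓ (suc n) k)) (sym (x*ₚ1ₚ γ[n∸g]≈1 k))) (γ-recurrence 1+ℓ≤n k)
    where
    γ[n∸g]≈1 : γP ℓ (n ∸ maxGap) ≈ₚ 1ₚ
    γ[n∸g]≈1 rewrite m≤n⇒m∸n≡0 n≤g = γ-0

  γ-recurrence-long : ∀ {n} → suc maxGap ≤ n →
                      γP ℓ n ≈ₚ (1ₚ +ₚ xₚ) *ₚ γP ℓ (n ∸ 1) -ₚ xₚ *ₚ γP ℓ (n ∸ suc maxGap)
  γ-recurrence-long {suc n} (s≤s g≤n) = +ₚ⇒-ₚ (γ-recurrence (≤-trans (m≤n+m (suc ℓ) ℓ) g≤n))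

  γ-recurrence-short : ∀ {n} → 1 ≤ n → n ≤ ℓ → γP ℓ (suc n) ≈ₚ (1ₚ +ₚ xₚ) *ₚ γP ℓ n +ₚ xₚ
  γ-recurrence-short {n} 1≤n n≤ℓ zero =
    trans (cong +_ (trans (#dom-suc-0 n) (sym (#dom-0≡0 1≤n))))
          (sym (trans (ℤ.+-identityʳ _) ([1+x]*ₚ-zero (γP ℓ n))))
  γ-recurrence-short {n} 1≤n n≤ℓ (suc zero) =
    trans (cong +_ deg1) (sym (cong (ℤ._+ + 1) ([1+x]*ₚ-suc (γP ℓ n) 0)))
    where
    deg1 : #dom (suc n) 1 ≡ #dom n 1 + #dom n 0 + 1
    deg1 rewrite #dom-1-≤ (s≤s n≤ℓ) | #dom-1-≤ (m≤n⇒m≤1+n n≤ℓ) | #dom-0≡0 1≤n | +-identityʳ n =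
      +-comm 1 n
  γ-recurrence-short {n} 1≤n n≤ℓ (suc (suc k)) =
    trans (cong +_ (trans (#dom-pascal-short n≤ℓ k) (sym (+-identityʳ _))))
          (sym (cong (ℤ._+ + 0) ([1+x]*ₚ-suc (γP ℓ n) (suc k))))

  γ-binomial : ∀ {n} → 1 ≤ n → n ≤ suc ℓ → γP ℓ n ≈ₚ (1ₚ +ₚ xₚ) ^ₚ n -ₚ 1ₚ
  γ-binomial {suc zero} _ _ k = trans (γ-1 k) (x≈[1+x]*1-1 k)
  γ-binomial {suc (suc n)} _ (s≤s 1+n≤ℓ) k =
    trans (γ-recurrence-short (s≤s z≤n) 1+n≤ℓ k)
          ([1+x]*[p-1]+x ((1ₚ +ₚ xₚ) ^ₚ suc n) (γ-binomial (s≤s z≤n) (m≤n⇒m≤1+n 1+n≤ℓ)) k)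

theorem5 : (ℓ : ℕ) → 1 ≤ ℓ →
    ( (γP ℓ 0 ≈ₚ 1ₚ)
    × (γP ℓ 1 ≈ₚ xₚ)
    × (∀ n → 2 ≤ n → n ≤ ℓ + 1 →
         γP ℓ n ≈ₚ n ·ₚ xₚ +ₚ xₚ *ₚ Σₚ (n ∸ 1) (λ j → γP ℓ (n ∸ j)))
    × (∀ n → ℓ + 2 ≤ n → n ≤ 2 * ℓ →
         γP ℓ n ≈ₚ (2 * ℓ + 2 ∸ n) ·ₚ xₚ +ₚ xₚ *ₚ Σₚ (n ∸ 1) (λ j → γP ℓ (n ∸ j)))
    × (∀ n → 2 * ℓ + 1 ≤ n →
         γP ℓ n ≈ₚ xₚ *ₚ Σₚ (2 * ℓ + 1) (λ j → γP ℓ (n ∸ j))) )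
    ×
    ( (γP ℓ 0 ≈ₚ 1ₚ)
    × (∀ n → 1 ≤ n → n ≤ ℓ + 1 →
         γP ℓ n ≈ₚ (1ₚ +ₚ xₚ) ^ₚ n -ₚ 1ₚ)
    × (∀ n → ℓ + 2 ≤ n → n ≤ 2 * ℓ + 1 →
         γP ℓ n ≈ₚ (1ₚ +ₚ xₚ) *ₚ γP ℓ (n ∸ 1) -ₚ xₚ)
    × (∀ n → 2 * ℓ + 2 ≤ n →
         γP ℓ n ≈ₚ (1ₚ +ₚ xₚ) *ₚ γP ℓ (n ∸ 1) -ₚ xₚ *ₚ γP ℓ (n ∸ 2 * (ℓ + 1))) )
theorem5 ℓ _ =
  ( γ-0
  , γ-1
  , (λ n 2≤n n≤ℓ+1 → γ-gap-short (≤-trans (n≤1+n 1) 2≤n) (≤-trans (ℓ+1⇒1+ℓ n≤ℓ+1) ℓ+1≤1+g)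
                                 (#dom-1-≤ (ℓ+1⇒1+ℓ n≤ℓ+1)))
  , (λ n ℓ+2≤n n≤2ℓ → γ-gap-short (≤-trans (s≤s z≤n) (ℓ+2⇒1+ℓ ℓ+2≤n)) (≤-trans n≤2ℓ 2ℓ≤1+g)
                                  (trans (#dom-1-≥ (ℓ+2⇒1+ℓ ℓ+2≤n)) (cong (_∸ n) (sym (2n+2≡1+n+[1+n] ℓ)))))
  , (λ n 2ℓ+1≤n → subst (λ M → γP ℓ n ≈ₚ xₚ *ₚ Σₚ M (λ j → γP ℓ (n ∸ j)))
                        (sym (2n+1≡n+[1+n] ℓ))
                        (γ-gap-long (subst (_≤ n) (2n+1≡n+[1+n] ℓ) 2ℓ+1≤n))) )
  , ( γ-0
    , (λ n 1≤n n≤ℓ+1 → γ-binomial 1≤n (ℓ+1⇒1+ℓ n≤ℓ+1))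
    , (λ n ℓ+2≤n n≤2ℓ+1 → γ-recurrence-middle (subst (_≤ n) (+-comm ℓ 2) ℓ+2≤n)
                            (≤-trans (subst (n ≤_) (2n+1≡n+[1+n] ℓ) n≤2ℓ+1) (n≤1+n maxGap)))
    , (λ n 2ℓ+2≤n → subst (λ m → γP ℓ n ≈ₚ (1ₚ +ₚ xₚ) *ₚ γP ℓ (n ∸ 1) -ₚ xₚ *ₚ γP ℓ (n ∸ m))
                          (sym (2[n+1]≡1+n+[1+n] ℓ))
                          (γ-recurrence-long (subst (_≤ n) (2n+2≡1+n+[1+n] ℓ) 2ℓ+2≤n))) )
  where
  open PathPower ℓ
  ℓ+1⇒1+ℓ : ∀ {n} → n ≤ ℓ + 1 → n ≤ suc ℓ
  ℓ+1⇒1+ℓ {n} = subst (n ≤_) (+-comm ℓ 1)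
  ℓ+2⇒1+ℓ : ∀ {n} → ℓ + 2 ≤ n → suc ℓ ≤ n
  ℓ+2⇒1+ℓ {n} ℓ+2≤n = ≤-trans (n≤1+n (suc ℓ)) (subst (_≤ n) (+-comm ℓ 2) ℓ+2≤n)
  ℓ+1≤1+g : suc ℓ ≤ suc maxGap
  ℓ+1≤1+g = s≤s (m≤m+n ℓ (suc ℓ))
  2ℓ≤1+g : 2 * ℓ ≤ suc maxGap
  2ℓ≤1+g = subst (2 * ℓ ≤_) (2n+2≡1+n+[1+n] ℓ) (m≤m+n (2 * ℓ) 2)
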